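{- Let $G$ be a nilpotent finite group, $N$ a cyclic normal subgroup of $G$ containing $G'=[G,G]$, and $S\subseteq G$ such that $\overline S$ is a minimal generating set of $\overline G=G/N$ with $\#S=\#\overline S\ge 2$. If $N\subseteq Z(G)$, then $\langle [s,t] : s,t\in S\rangle = G'$.
   Context: $g\mapsto \overline g$ is the natural map $G\to G/N$; $Z(G)$ is the center; $[s,t]=s^{ -1}t^{ -1}st$. -}

module Defs where

open import Level using (Level; _⊔_) renaming (suc to lsuc)
open import Algebra.Bundles using (Group)
open import Algebra.Structures using (IsGroup; IsMonoid; IsSemigroup; IsMagma)
import Algebra.Properties.Group as GroupProps
open import Data.Nat using (ℕ; zero; suc)
open import Data.Product using (Σ; ∃; ∃₂; _×_; _,_)
open import Data.Unit.Polymorphic using (⊤)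
open import Data.List using (List)
open import Data.List.Relation.Unary.Any using (Any)
open import Relation.Unary using (Pred; _∈_; _⊆_)
open import Relation.Binary using (_Respects_; IsEquivalence)
import Relation.Binary.Reasoning.Setoid as SetoidReasoning

module _ {c ℓ} (G : Group c ℓ) where
  open Group G

  commutator : Carrier → Carrier → Carrier
  commutator s t = s ⁻¹ ∙ t ⁻¹ ∙ s ∙ t

  data Gen {q} (A : Pred Carrier q) : Pred Carrier (c ⊔ ℓ ⊔ q) where
    gen  : ∀ {x} → A x → Gen A x
    gen-ε    : Gen A ε
    gen-∙    : ∀ {x y} → Gen A x → Gen A y → Gen A (x ∙ y)
    gen-⁻¹   : ∀ {x} → Gen A x → Gen A (x ⁻¹)
    gen-resp : ∀ {x y} → x ≈ y → Gen A x → Gen A y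

  Generates : ∀ {q} → Pred Carrier q → Set (c ⊔ ℓ ⊔ q)
  Generates A = ∀ x → Gen A x

  IsMinimalGeneratingSet : ∀ {q} → Pred Carrier q → Set (c ⊔ ℓ ⊔ lsuc q)
  IsMinimalGeneratingSet {q} A =
    Generates A ×
    (∀ (T : Pred Carrier q) → T Respects _≈_ → T ⊆ A → Generates T → A ⊆ T)

  Commutators : ∀ {q} → Pred Carrier q → Pred Carrier (c ⊔ ℓ ⊔ q)
  Commutators S x = ∃₂ λ s t → S s × S t × x ≈ commutator s t

  DerivedSubgroup : Pred Carrier (c ⊔ ℓ)
  DerivedSubgroup = Gen (λ x → ∃₂ λ s t → x ≈ commutator s t)

  Center : Pred Carrier (c ⊔ ℓ)
  Center z = ∀ g → z ∙ g ≈ g ∙ z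

  lowerCentral : ℕ → Pred Carrier (c ⊔ ℓ)
  lowerCentral zero    = λ _ → ⊤
  lowerCentral (suc i) =
    Gen (λ x → ∃₂ λ a b → lowerCentral i a × x ≈ commutator a b)

  IsNilpotent : Set (c ⊔ ℓ)
  IsNilpotent = ∃ λ n → ∀ x → lowerCentral n x → x ≈ ε

  IsFinite : Set (c ⊔ ℓ)
  IsFinite = Σ (List Carrier) λ xs → ∀ x → Any (x ≈_) xs

  record NormalSubgroup p : Set (c ⊔ ℓ ⊔ lsuc p) where
    field
      mem   : Pred Carrier p
      resp  : mem Respects _≈_
      ε∈    : mem ε
      ∙∈    : ∀ {x y} → mem x → mem y → mem (x ∙ y)
      ⁻¹∈   : ∀ {x} → mem x → mem (x ⁻¹)
      conj∈ : ∀ g {x} → mem x → mem (g ⁻¹ ∙ x ∙ g)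

  IsCyclic : ∀ {p} → NormalSubgroup p → Set (c ⊔ ℓ ⊔ p)
  IsCyclic N = ∃ λ g → mem g × (mem ⊆ Gen (g ≈_))
    where open NormalSubgroup N

-- The quotient group G/N, as a setoid quotient: same carrier, with
-- x ≈ y in G/N iff x⁻¹ y ∈ N.  The natural map g ↦ ḡ is the identity
-- on carriers.

module Quotient {c ℓ p} (G : Group c ℓ) (N : NormalSubgroup G p) where
  open Group G
  open NormalSubgroup N
  open GroupProps G
  open SetoidReasoning setoid

  infix 4 _~_
  _~_ : Carrier → Carrier → Set p
  x ~ y = mem (x ⁻¹ ∙ y)

  ≈⇒~ : ∀ {x y} → x ≈ y → x ~ y
  ≈⇒~ {x} {y} x≈y = resp (begin
    ε          ≈⟨ sym (inverseˡ x) ⟩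
    x ⁻¹ ∙ x   ≈⟨ ∙-congˡ x≈y ⟩
    x ⁻¹ ∙ y   ∎) ε∈

  ~-refl : ∀ {x} → x ~ x
  ~-refl = ≈⇒~ refl

  ~-sym : ∀ {x y} → x ~ y → y ~ x
  ~-sym {x} {y} h = resp (begin
    (x ⁻¹ ∙ y) ⁻¹      ≈⟨ ⁻¹-anti-homo-∙ (x ⁻¹) y ⟩
    y ⁻¹ ∙ x ⁻¹ ⁻¹     ≈⟨ ∙-congˡ (⁻¹-involutive x) ⟩
    y ⁻¹ ∙ x           ∎) (⁻¹∈ h)

  ~-trans : ∀ {x y z} → x ~ y → y ~ z → x ~ z
  ~-trans {x} {y} {z} h k = resp (begin
    (x ⁻¹ ∙ y) ∙ (y ⁻¹ ∙ z)   ≈⟨ assoc (x ⁻¹) y (y ⁻¹ ∙ z) ⟩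
    x ⁻¹ ∙ (y ∙ (y ⁻¹ ∙ z))   ≈⟨ ∙-congˡ (sym (assoc y (y ⁻¹) z)) ⟩
    x ⁻¹ ∙ ((y ∙ y ⁻¹) ∙ z)   ≈⟨ ∙-congˡ (∙-congʳ (inverseʳ y)) ⟩
    x ⁻¹ ∙ (ε ∙ z)            ≈⟨ ∙-congˡ (identityˡ z) ⟩
    x ⁻¹ ∙ z                  ∎) (∙∈ h k)

  ~-∙-cong : ∀ {x x′ y y′} → x ~ x′ → y ~ y′ → (x ∙ y) ~ (x′ ∙ y′)
  ~-∙-cong {x} {x′} {y} {y′} h k = resp eq (∙∈ (conj∈ y h) k)
    where
    eq : y ⁻¹ ∙ (x ⁻¹ ∙ x′) ∙ y ∙ (y ⁻¹ ∙ y′) ≈ (x ∙ y) ⁻¹ ∙ (x′ ∙ y′)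
    eq = begin
      y ⁻¹ ∙ (x ⁻¹ ∙ x′) ∙ y ∙ (y ⁻¹ ∙ y′)   ≈⟨ assoc _ y _ ⟩
      y ⁻¹ ∙ (x ⁻¹ ∙ x′) ∙ (y ∙ (y ⁻¹ ∙ y′)) ≈⟨ ∙-congˡ (sym (assoc y (y ⁻¹) y′)) ⟩
      y ⁻¹ ∙ (x ⁻¹ ∙ x′) ∙ ((y ∙ y ⁻¹) ∙ y′) ≈⟨ ∙-congˡ (∙-congʳ (inverseʳ y)) ⟩
      y ⁻¹ ∙ (x ⁻¹ ∙ x′) ∙ (ε ∙ y′)          ≈⟨ ∙-congˡ (identityˡ y′) ⟩
      y ⁻¹ ∙ (x ⁻¹ ∙ x′) ∙ y′                ≈⟨ ∙-congʳ (sym (assoc _ _ _)) ⟩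
      y ⁻¹ ∙ x ⁻¹ ∙ x′ ∙ y′                  ≈⟨ assoc _ x′ y′ ⟩
      y ⁻¹ ∙ x ⁻¹ ∙ (x′ ∙ y′)                ≈⟨ ∙-congʳ (sym (⁻¹-anti-homo-∙ x y)) ⟩
      (x ∙ y) ⁻¹ ∙ (x′ ∙ y′)                 ∎

  ~-⁻¹-cong : ∀ {x y} → x ~ y → (x ⁻¹) ~ (y ⁻¹)
  ~-⁻¹-cong {x} {y} h = resp eq (conj∈ (x ⁻¹) (~-sym h))
    where
    eq : x ⁻¹ ⁻¹ ∙ (y ⁻¹ ∙ x) ∙ x ⁻¹ ≈ x ⁻¹ ⁻¹ ∙ y ⁻¹
    eq = begin
      x ⁻¹ ⁻¹ ∙ (y ⁻¹ ∙ x) ∙ x ⁻¹   ≈⟨ assoc _ _ _ ⟩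
      x ⁻¹ ⁻¹ ∙ ((y ⁻¹ ∙ x) ∙ x ⁻¹) ≈⟨ ∙-congˡ (assoc _ _ _) ⟩
      x ⁻¹ ⁻¹ ∙ (y ⁻¹ ∙ (x ∙ x ⁻¹)) ≈⟨ ∙-congˡ (∙-congˡ (inverseʳ x)) ⟩
      x ⁻¹ ⁻¹ ∙ (y ⁻¹ ∙ ε)          ≈⟨ ∙-congˡ (identityʳ _) ⟩
      x ⁻¹ ⁻¹ ∙ y ⁻¹                ∎

  quotientIsGroup : IsGroup _~_ _∙_ ε _⁻¹
  quotientIsGroup = record
    { isMonoid = record
      { isSemigroup = record
        { isMagma = record
          { isEquivalence = record { refl = ~-refl ; sym = ~-sym ; trans = ~-trans }
          ; ∙-cong = ~-∙-cong }
        ; assoc = λ x y z → ≈⇒~ (assoc x y z) }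
      ; identity = (λ x → ≈⇒~ (identityˡ x)) , (λ x → ≈⇒~ (identityʳ x)) }
    ; inverse = (λ x → ≈⇒~ (inverseˡ x)) , (λ x → ≈⇒~ (inverseʳ x))
    ; ⁻¹-cong = ~-⁻¹-cong }

  quotientGroup : Group c p
  quotientGroup = record { isGroup = quotientIsGroup }

_/_ : ∀ {c ℓ p} (G : Group c ℓ) → NormalSubgroup G p → Group c p
G / N = Quotient.quotientGroup G N

image : ∀ {c ℓ p q} (G : Group c ℓ) (N : NormalSubgroup G p) →
        Pred (Group.Carrier G) q → Pred (Group.Carrier G) (c ⊔ p ⊔ q)
image G N S x = ∃ λ s → S s × Quotient._~_ G N s x

module Submission where

-- Since G′ ⊆ N ⊆ Z(G), every commutator is central, so G has
-- class at most two and the commutator map is a homomorphism in each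
-- argument: [x y , z] = [x , z] [y , z] and [y , x] = [x , y]⁻¹.
-- Consequently, for H = ⟨[s,t] : s,t ∈ S⟩, the commutator [w , w′] lies in H
-- whenever w, w′ ∈ ⟨S⟩ (induction on the generation of w and of w′).
-- Because S̄ generates G/N and N is central, every element of G factors as
-- w n with w ∈ ⟨S⟩ and n ∈ N; central factors do not change a commutator,
-- so [w n , w′ n′] = [w , w′] ∈ H.  Hence every commutator of G lies in H,
-- giving G′ ⊆ H, while H ⊆ G′ is immediate.

open import Defs
open import Algebra.Bundles using (Group)
open import Data.Product using (∃₂; _×_; _,_)
open import Relation.Nullary using (¬_)
open import Relation.Unary using (Pred; _⊆_; _≐_)
import Algebra.Properties.Group as GroupProps
import Relation.Binary.Reasoning.Setoid as SetoidReasoning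

-- ⟨A⟩ is the least subgroup containing A; here stated against generated
-- subgroups ⟨B⟩, which is all the proof needs.
Gen-least : ∀ {c ℓ a b} (G : Group c ℓ) {A : Pred (Group.Carrier G) a}
            {B : Pred (Group.Carrier G) b} → A ⊆ Gen G B → Gen G A ⊆ Gen G B
Gen-least G A⊆B (gen x∈A)    = A⊆B x∈A
Gen-least G A⊆B gen-ε        = gen-ε
Gen-least G A⊆B (gen-∙ x y)  = gen-∙ (Gen-least G A⊆B x) (Gen-least G A⊆B y)
Gen-least G A⊆B (gen-⁻¹ x)   = gen-⁻¹ (Gen-least G A⊆B x)
Gen-least G A⊆B (gen-resp e x) = gen-resp e (Gen-least G A⊆B x)

module CommutatorLaws {c ℓ} (G : Group c ℓ) where
  open Group G
  open GroupProps G
  open SetoidReasoning setoid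

  [_,_] : Carrier → Carrier → Carrier
  [ x , y ] = commutator G x y

  cancelˡ : ∀ u v → u ⁻¹ ∙ (u ∙ v) ≈ v
  cancelˡ u v = begin
    u ⁻¹ ∙ (u ∙ v)  ≈⟨ sym (assoc _ _ _) ⟩
    (u ⁻¹ ∙ u) ∙ v  ≈⟨ ∙-congʳ (inverseˡ u) ⟩
    ε ∙ v           ≈⟨ identityˡ v ⟩
    v               ∎

  commutator-quotient : ∀ a b → [ a , b ] ≈ (b ∙ a) ⁻¹ ∙ (a ∙ b)
  commutator-quotient a b = begin
    a ⁻¹ ∙ b ⁻¹ ∙ a ∙ b       ≈⟨ assoc _ _ _ ⟩
    (a ⁻¹ ∙ b ⁻¹) ∙ (a ∙ b)   ≈⟨ ∙-congʳ (sym (⁻¹-anti-homo-∙ b a)) ⟩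
    (b ∙ a) ⁻¹ ∙ (a ∙ b)      ∎

  swap-correction : ∀ a b → a ∙ b ≈ b ∙ a ∙ [ a , b ]
  swap-correction a b = begin
    a ∙ b                                   ≈⟨ sym (cancelˡ ((b ∙ a) ⁻¹) (a ∙ b)) ⟩
    (b ∙ a) ⁻¹ ⁻¹ ∙ ((b ∙ a) ⁻¹ ∙ (a ∙ b))  ≈⟨ ∙-congʳ (⁻¹-involutive (b ∙ a)) ⟩
    b ∙ a ∙ ((b ∙ a) ⁻¹ ∙ (a ∙ b))          ≈⟨ ∙-congˡ (sym (commutator-quotient a b)) ⟩
    b ∙ a ∙ [ a , b ]                       ∎

  commutator-unique : ∀ a b z → a ∙ b ≈ b ∙ a ∙ z → [ a , b ] ≈ z
  commutator-unique a b z ab≈baz = begin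
    [ a , b ]                  ≈⟨ commutator-quotient a b ⟩
    (b ∙ a) ⁻¹ ∙ (a ∙ b)       ≈⟨ ∙-congˡ ab≈baz ⟩
    (b ∙ a) ⁻¹ ∙ (b ∙ a ∙ z)   ≈⟨ cancelˡ (b ∙ a) z ⟩
    z                          ∎

  commutator-congˡ : ∀ {x x′} z → x ≈ x′ → [ x , z ] ≈ [ x′ , z ]
  commutator-congˡ z x≈x′ = ∙-congʳ (∙-cong (∙-congʳ (⁻¹-cong x≈x′)) x≈x′)

  commutator-congʳ : ∀ z {y y′} → y ≈ y′ → [ z , y ] ≈ [ z , y′ ]
  commutator-congʳ z y≈y′ = ∙-cong (∙-congʳ (∙-congˡ (⁻¹-cong y≈y′))) y≈y′

  commutator-flip : ∀ x y → [ x , y ] ⁻¹ ≈ [ y , x ]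
  commutator-flip x y = sym (commutator-unique y x _ (begin
    y ∙ x                                ≈⟨ sym (identityʳ _) ⟩
    y ∙ x ∙ ε                            ≈⟨ ∙-congˡ (sym (inverseʳ _)) ⟩
    y ∙ x ∙ ([ x , y ] ∙ [ x , y ] ⁻¹)   ≈⟨ sym (assoc _ _ _) ⟩
    y ∙ x ∙ [ x , y ] ∙ [ x , y ] ⁻¹     ≈⟨ ∙-congʳ (sym (swap-correction x y)) ⟩
    x ∙ y ∙ [ x , y ] ⁻¹                 ∎))

  commutator-centralˡ : ∀ {n} b → Center G n → [ n , b ] ≈ ε
  commutator-centralˡ {n} b n-central = commutator-unique n b ε (begin
    n ∙ b      ≈⟨ n-central b ⟩
    b ∙ n      ≈⟨ sym (identityʳ _) ⟩
    b ∙ n ∙ ε  ∎)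

  ε-central : Center G ε
  ε-central g = trans (identityˡ g) (sym (identityʳ g))

module ClassTwo {c ℓ} (G : Group c ℓ)
  (commutators-central : ∀ x y → Center G (commutator G x y)) where
  open Group G
  open GroupProps G
  open SetoidReasoning setoid
  open CommutatorLaws G

  commutator-∙ˡ : ∀ x y z → [ x ∙ y , z ] ≈ [ x , z ] ∙ [ y , z ]
  commutator-∙ˡ x y z = commutator-unique _ _ _ (begin
    x ∙ y ∙ z                  ≈⟨ assoc _ _ _ ⟩
    x ∙ (y ∙ z)                ≈⟨ ∙-congˡ (swap-correction y z) ⟩
    x ∙ (z ∙ y ∙ c₂)           ≈⟨ ∙-congˡ (assoc _ _ _) ⟩
    x ∙ (z ∙ (y ∙ c₂))         ≈⟨ sym (assoc _ _ _) ⟩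
    x ∙ z ∙ (y ∙ c₂)           ≈⟨ ∙-congʳ (swap-correction x z) ⟩
    z ∙ x ∙ c₁ ∙ (y ∙ c₂)      ≈⟨ assoc _ _ _ ⟩
    z ∙ x ∙ (c₁ ∙ (y ∙ c₂))    ≈⟨ ∙-congˡ (sym (assoc _ _ _)) ⟩
    z ∙ x ∙ (c₁ ∙ y ∙ c₂)      ≈⟨ ∙-congˡ (∙-congʳ (commutators-central x z y)) ⟩
    z ∙ x ∙ (y ∙ c₁ ∙ c₂)      ≈⟨ ∙-congˡ (assoc _ _ _) ⟩
    z ∙ x ∙ (y ∙ (c₁ ∙ c₂))    ≈⟨ sym (assoc _ _ _) ⟩
    z ∙ x ∙ y ∙ (c₁ ∙ c₂)      ≈⟨ ∙-congʳ (assoc _ _ _) ⟩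
    z ∙ (x ∙ y) ∙ (c₁ ∙ c₂)    ∎)
    where
    c₁ = [ x , z ]
    c₂ = [ y , z ]

  commutator-⁻¹ˡ : ∀ x z → [ x ⁻¹ , z ] ≈ [ x , z ] ⁻¹
  commutator-⁻¹ˡ x z = inverseʳ-unique _ _ (begin
    [ x , z ] ∙ [ x ⁻¹ , z ]  ≈⟨ sym (commutator-∙ˡ x (x ⁻¹) z) ⟩
    [ x ∙ x ⁻¹ , z ]          ≈⟨ commutator-congˡ z (inverseʳ x) ⟩
    [ ε , z ]                 ≈⟨ commutator-centralˡ z ε-central ⟩
    ε                         ∎)

  absorb-centralˡ : ∀ w {n} b → Center G n → [ w ∙ n , b ] ≈ [ w , b ]
  absorb-centralˡ w {n} b n-central = begin
    [ w ∙ n , b ]            ≈⟨ commutator-∙ˡ w n b ⟩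
    [ w , b ] ∙ [ n , b ]    ≈⟨ ∙-congˡ (commutator-centralˡ b n-central) ⟩
    [ w , b ] ∙ ε            ≈⟨ identityʳ _ ⟩
    [ w , b ]                ∎

  absorb-centralʳ : ∀ a w {n} → Center G n → [ a , w ∙ n ] ≈ [ a , w ]
  absorb-centralʳ a w {n} n-central = begin
    [ a , w ∙ n ]          ≈⟨ sym (commutator-flip (w ∙ n) a) ⟩
    [ w ∙ n , a ] ⁻¹       ≈⟨ ⁻¹-cong (absorb-centralˡ w a n-central) ⟩
    [ w , a ] ⁻¹           ≈⟨ commutator-flip w a ⟩
    [ a , w ]              ∎

  -- Bilinearity lifts commutators of generators to the generated
  -- subgroup: [w , w′] ∈ ⟨[S,S]⟩ for all w, w′ ∈ ⟨S⟩.
  module _ {q} (S : Pred Carrier q) where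
    H : Pred Carrier _
    H = Gen G (Commutators G S)

    commutator-genˡ : ∀ {z} → (∀ {s} → S s → H [ s , z ]) →
                      ∀ {w} → Gen G S w → H [ w , z ]
    commutator-genˡ on-S (gen s∈S)  = on-S s∈S
    commutator-genˡ {z} on-S gen-ε =
      gen-resp (sym (commutator-centralˡ z ε-central)) gen-ε
    commutator-genˡ {z} on-S (gen-∙ {x} {y} x∈ y∈) =
      gen-resp (sym (commutator-∙ˡ x y z))
               (gen-∙ (commutator-genˡ on-S x∈) (commutator-genˡ on-S y∈))
    commutator-genˡ {z} on-S (gen-⁻¹ {x} x∈) =
      gen-resp (sym (commutator-⁻¹ˡ x z)) (gen-⁻¹ (commutator-genˡ on-S x∈))
    commutator-genˡ {z} on-S (gen-resp x≈y x∈) =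
      gen-resp (commutator-congˡ z x≈y) (commutator-genˡ on-S x∈)

    H-flip : ∀ {x y} → H [ x , y ] → H [ y , x ]
    H-flip {x} {y} h = gen-resp (commutator-flip x y) (gen-⁻¹ h)

    commutator-gen : ∀ {w w′} → Gen G S w → Gen G S w′ → H [ w , w′ ]
    commutator-gen w∈ w′∈ = commutator-genˡ (λ s∈S →
      H-flip (commutator-genˡ (λ {t} t∈S → gen (t , _ , t∈S , s∈S , refl)) w′∈))
      w∈

module CentralFactorisation {c ℓ p q} (G : Group c ℓ) (N : NormalSubgroup G p)
  (N-central : NormalSubgroup.mem N ⊆ Center G) (A : Pred (Group.Carrier G) q) where
  open Group G
  open NormalSubgroup N
  open GroupProps G
  open SetoidReasoning setoid
  open CommutatorLaws G using (cancelˡ)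

  FactorsThroughN : Pred Carrier _
  FactorsThroughN x = ∃₂ λ w n → Gen G A w × mem n × x ≈ w ∙ n

  factor-∙ : ∀ {x y} → FactorsThroughN x → FactorsThroughN y → FactorsThroughN (x ∙ y)
  factor-∙ {x} {y} (w , n , w∈ , n∈ , x≈) (w′ , n′ , w′∈ , n′∈ , y≈) =
    w ∙ w′ , n ∙ n′ , gen-∙ w∈ w′∈ , ∙∈ n∈ n′∈ , (begin
      x ∙ y                  ≈⟨ ∙-cong x≈ y≈ ⟩
      w ∙ n ∙ (w′ ∙ n′)      ≈⟨ assoc _ _ _ ⟩
      w ∙ (n ∙ (w′ ∙ n′))    ≈⟨ ∙-congˡ (sym (assoc _ _ _)) ⟩
      w ∙ (n ∙ w′ ∙ n′)      ≈⟨ ∙-congˡ (∙-congʳ (N-central n∈ w′)) ⟩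
      w ∙ (w′ ∙ n ∙ n′)      ≈⟨ ∙-congˡ (assoc _ _ _) ⟩
      w ∙ (w′ ∙ (n ∙ n′))    ≈⟨ sym (assoc _ _ _) ⟩
      w ∙ w′ ∙ (n ∙ n′)      ∎)

  factor-⁻¹ : ∀ {x} → FactorsThroughN x → FactorsThroughN (x ⁻¹)
  factor-⁻¹ {x} (w , n , w∈ , n∈ , x≈) =
    w ⁻¹ , n ⁻¹ , gen-⁻¹ w∈ , ⁻¹∈ n∈ , (begin
      x ⁻¹          ≈⟨ ⁻¹-cong x≈ ⟩
      (w ∙ n) ⁻¹    ≈⟨ ⁻¹-anti-homo-∙ w n ⟩
      n ⁻¹ ∙ w ⁻¹   ≈⟨ N-central (⁻¹∈ n∈) (w ⁻¹) ⟩
      w ⁻¹ ∙ n ⁻¹   ∎)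

  factor-~ : ∀ {x y} → Quotient._~_ G N x y → FactorsThroughN x → FactorsThroughN y
  factor-~ {x} {y} x~y (w , n , w∈ , n∈ , x≈) =
    w , n ∙ (x ⁻¹ ∙ y) , w∈ , ∙∈ n∈ x~y , (begin
      y                       ≈⟨ sym (cancelˡ (x ⁻¹) y) ⟩
      x ⁻¹ ⁻¹ ∙ (x ⁻¹ ∙ y)    ≈⟨ ∙-congʳ (⁻¹-involutive x) ⟩
      x ∙ (x ⁻¹ ∙ y)          ≈⟨ ∙-congʳ x≈ ⟩
      w ∙ n ∙ (x ⁻¹ ∙ y)      ≈⟨ assoc _ _ _ ⟩
      w ∙ (n ∙ (x ⁻¹ ∙ y))    ∎)

  factorise : Gen (G / N) (image G N A) ⊆ FactorsThroughN
  factorise (gen (a , a∈A , a~x)) =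
    factor-~ a~x (a , ε , gen a∈A , ε∈ , sym (identityʳ a))
  factorise gen-ε            = ε , ε , gen-ε , ε∈ , sym (identityʳ ε)
  factorise (gen-∙ x∈ y∈)    = factor-∙ (factorise x∈) (factorise y∈)
  factorise (gen-⁻¹ x∈)      = factor-⁻¹ (factorise x∈)
  factorise (gen-resp x~y x∈) = factor-~ x~y (factorise x∈)

-- Lemma 3.11.  Only G′ ⊆ N ⊆ Z(G) and the generation of G/N by S̄ are used.
lemma3p11 : ∀ {c ℓ p} (G : Group c ℓ) → IsFinite G → IsNilpotent G →
    (N : NormalSubgroup G p) → IsCyclic G N →
    DerivedSubgroup G ⊆ NormalSubgroup.mem N →
    (S : Pred (Group.Carrier G) p) →
    IsMinimalGeneratingSet (G / N) (image G N S) →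
    (∀ {s t} → S s → S t → Quotient._~_ G N s t → Group._≈_ G s t) →
    (∃₂ λ s t → S s × S t × ¬ Group._≈_ G s t) →
    NormalSubgroup.mem N ⊆ Center G →
    Gen G (Commutators G S) ≐ DerivedSubgroup G
lemma3p11 G _ _ N _ G′⊆N S (S̄-generates , _) _ _ N⊆Z =
  Gen-least G (λ { (s , t , _ , _ , e) → gen (s , t , e) }) ,
  Gen-least G (λ { (a , b , e) → gen-resp (sym e) (every-commutator-in-H a b) })
  where
  open Group G using (setoid; _≈_; _∙_; sym; refl)
  open SetoidReasoning setoid
  open CommutatorLaws G using ([_,_]; commutator-congˡ; commutator-congʳ)
  open CentralFactorisation G N N⊆Z S using (factorise)

  commutators-central : ∀ x y → Center G (commutator G x y)
  commutators-central x y = N⊆Z (G′⊆N (gen (x , y , refl)))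

  open ClassTwo G commutators-central

  -- a = w n and b = w′ n′ with n, n′ central, so [a , b] = [w , w′] ∈ H.
  every-commutator-in-H : ∀ a b → H S [ a , b ]
  every-commutator-in-H a b with factorise (S̄-generates a) | factorise (S̄-generates b)
  ... | w , n , w∈ , n∈N , a≈wn | w′ , n′ , w′∈ , n′∈N , b≈w′n′ =
    gen-resp (sym [a,b]≈[w,w′]) (commutator-gen S w∈ w′∈)
    where
    [a,b]≈[w,w′] : [ a , b ] ≈ [ w , w′ ]
    [a,b]≈[w,w′] = begin
      [ a , b ]              ≈⟨ commutator-congˡ b a≈wn ⟩
      [ w ∙ n , b ]          ≈⟨ absorb-centralˡ w b (N⊆Z n∈N) ⟩
      [ w , b ]              ≈⟨ commutator-congʳ w b≈w′n′ ⟩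
      [ w , w′ ∙ n′ ]        ≈⟨ absorb-centralʳ w w′ (N⊆Z n′∈N) ⟩
      [ w , w′ ]             ∎
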